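{- Let $\mathbb{K}$ be an algebraically closed field of characteristic $p>0$, let $k$ be a perfect subfield of $\mathbb{K}$, and let $\bar a=(a_0,\dots,a_{n-1})\in k^n$ be a tuple of nonzero elements such that $\frac1{a_0},\dots,\frac1{a_{n-1}}$ are linearly independent over $\mathbb{F}_p$. Then $G_{\bar a}$ is isomorphic over $k$ (i.e. via a $k$-definable algebraic group isomorphism) to $(\mathbb{K},+)$. In particular, for any field $K$ with $k\le K\le\mathbb{K}$, the group $G_{\bar a}(K)$ is isomorphic to $(K,+)$.
   Context: Let $\wp(x)=x^p-x$. For a single element $a$, $G_a=(\mathbb{K},+)$. For a tuple $\bar a=(a_0,\dots,a_{m-1})$ with $m>1$, $G_{\bar a}=\{(x_0,\dots,x_{m-1})\in\mathbb{K}^m: a_0\wp(x_0)=a_i\wp(x_i)\text{ for all }0\le i<m\}$. For a subfield $K$, $G_{\bar a}(K)=G_{\bar a}\cap K^m$. -}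

module Defs where

open import Data.Nat using (ℕ; zero; suc)
open import Data.Fin using (Fin; toℕ)
open import Data.Product using (Σ; ∃; _×_; _,_)
open import Relation.Binary.PropositionalEquality using (_≡_; _≢_)
open import Algebra.Structures using (IsCommutativeRing)
open import Data.Nat.Primality using (Prime)

-- A field, with propositional equality as its equality.
-- _⁻¹ is a total operation; only its value on nonzero elements matters.
record Field : Set₁ where
  infixl 7 _*_
  infixl 6 _+_
  field
    Carrier : Set
    _+_ _*_ : Carrier → Carrier → Carrier
    -_ : Carrier → Carrier
    _⁻¹ : Carrier → Carrier
    0# 1# : Carrier
    isCommutativeRing : IsCommutativeRing _≡_ _+_ _*_ -_ 0# 1#
    0≢1 : 0# ≢ 1#
    inverseʳ : ∀ x → x ≢ 0# → x * (x ⁻¹) ≡ 1#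

module _ (F : Field) where
  open Field F

  pow : Carrier → ℕ → Carrier
  pow x zero = 1#
  pow x (suc n) = x * pow x n

  fromℕ : ℕ → Carrier
  fromℕ zero = 0#
  fromℕ (suc n) = 1# + fromℕ n

  sumFin : (n : ℕ) → (Fin n → Carrier) → Carrier
  sumFin zero f = 0#
  sumFin (suc n) f = f Fin.zero + sumFin n (λ i → f (Fin.suc i))

  HasChar : ℕ → Set
  HasChar p = Prime p × (fromℕ p ≡ 0#)

  AlgClosed : Set
  AlgClosed = ∀ (d : ℕ) (c : Fin (suc d) → Carrier) →
    ∃ λ x → pow x (suc d) + sumFin (suc d) (λ i → c i * pow x (toℕ i)) ≡ 0#

  record IsSubfield (S : Carrier → Set) : Set where
    field
      0∈ : S 0#
      1∈ : S 1#
      +∈ : ∀ {x y} → S x → S y → S (x + y)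
      *∈ : ∀ {x y} → S x → S y → S (x * y)
      -∈ : ∀ {x} → S x → S (- x)
      ⁻¹∈ : ∀ {x} → S x → x ≢ 0# → S (x ⁻¹)

  IsPerfect : ℕ → (Carrier → Set) → Set
  IsPerfect p S = ∀ {x} → S x → ∃ λ y → S y × (pow y p ≡ x)

  ℘ : ℕ → Carrier → Carrier
  ℘ p x = pow x p + (- x)

  G : ℕ → {m : ℕ} → (Fin (suc m) → Carrier) → (Fin (suc m) → Carrier) → Set
  G p a x = ∀ i → a Fin.zero * ℘ p (x Fin.zero) ≡ a i * ℘ p (x i)

  InvLinIndep : (p n : ℕ) → (Fin n → Carrier) → Set
  InvLinIndep p n a = ∀ (c : Fin n → Fin p) →
    sumFin n (λ i → fromℕ (toℕ (c i)) * (a i ⁻¹)) ≡ 0# → ∀ i → toℕ (c i) ≡ 0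

  data Poly (m : ℕ) : Set where
    var : Fin m → Poly m
    con : Carrier → Poly m
    _⊕_ _⊗_ : Poly m → Poly m → Poly m
    ⊝_ : Poly m → Poly m

  eval : {m : ℕ} → (Fin m → Carrier) → Poly m → Carrier
  eval v (var i) = v i
  eval v (con c) = c
  eval v (P ⊕ Q) = eval v P + eval v Q
  eval v (P ⊗ Q) = eval v P * eval v Q
  eval v (⊝ P) = - eval v P

  DefinedOver : (Carrier → Set) → {m : ℕ} → Poly m → Set
  DefinedOver S (var i) = ⊤' where open import Data.Unit using () renaming (⊤ to ⊤')
  DefinedOver S (con c) = S c
  DefinedOver S (P ⊕ Q) = DefinedOver S P × DefinedOver S Q
  DefinedOver S (P ⊗ Q) = DefinedOver S P × DefinedOver S Q
  DefinedOver S (⊝ P) = DefinedOver S P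

  -- G_{ā} is isomorphic over S to (K,+) as an algebraic group:
  -- a polynomial map f : K → K^(m+1) and a polynomial g : K^(m+1) → K, both
  -- defined over S, with f a group homomorphism into G_{ā} and g its inverse on G_{ā}.
  IsoOverToGa : ℕ → (Carrier → Set) → {m : ℕ} → (Fin (suc m) → Carrier) → Set
  IsoOverToGa p S {m} a =
    Σ (Fin (suc m) → Poly 1) λ f → Σ (Poly (suc m)) λ g →
      (∀ i → DefinedOver S (f i)) × DefinedOver S g ×
      (∀ x → G p a (λ i → eval (λ _ → x) (f i))) ×
      (∀ x y i → eval (λ _ → x + y) (f i) ≡ eval (λ _ → x) (f i) + eval (λ _ → y) (f i)) ×
      (∀ x → eval (λ i → eval (λ _ → x) (f i)) g ≡ x) ×
      (∀ v → G p a v → ∀ i → eval (λ _ → eval v g) (f i) ≡ v i)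

  GroupIsoPoints : ℕ → (Carrier → Set) → {m : ℕ} → (Fin (suc m) → Carrier) → Set
  GroupIsoPoints p L {m} a =
    Σ (Carrier → Fin (suc m) → Carrier) λ φ →
      (∀ {x} → L x → G p a (φ x) × (∀ i → L (φ x i))) ×
      (∀ {x y} → L x → L y → ∀ i → φ (x + y) i ≡ φ x i + φ y i) ×
      (∀ {x y} → L x → L y → (∀ i → φ x i ≡ φ y i) → x ≡ y) ×
      (∀ v → G p a v → (∀ i → L (v i)) → ∃ λ x → L x × (∀ i → φ x i ≡ v i))

module Submission where

-- Corollary 5.4: for a perfect field k of characteristic p and nonzero
-- a₀, …, aₘ ∈ k whose inverses are linearly independent over Fₚ, the group
-- G_a = {x : a₀℘(x₀) = aᵢ℘(xᵢ)} is isomorphic over k to 𝔾ₐ = (𝕂, +), hence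
-- G_a(K) ≅ (K, +) for every field k ⊆ K ⊆ 𝕂.
--
-- The proof is by induction on m.  For m = 0, G_a is 𝔾ₐ.  For m > 0 choose
-- βⱼ ∈ k with βⱼᵖ = a₀/aⱼ₊₁ (k is perfect) and put eⱼ = βⱼ - βⱼᵖ.  The
-- explicit polynomial maps of the module Lift identify G_a with G_{a′} for
-- a′ⱼ = 1/eⱼ, and a′ again satisfies the hypotheses: the key point
-- (Reduction.Step.β-independent) is that an Fₚ-relation Σ cⱼβⱼ = Σ cⱼβⱼᵖ makes
-- w = Σ cⱼβⱼᵖ a fixed point of Frobenius, hence an element of Fₚ, which turns
-- it into a relation among the 1/aᵢ.

open import Defs
open import Level using (0ℓ)
open import Data.Nat as ℕ using (ℕ; zero; suc; _<_; _≤_; z≤n; s≤s; NonZero)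
import Data.Nat.Properties as ℕP
open import Data.Nat.Combinatorics using (_C_; nCn≡1)
open import Data.Nat.Divisibility using (_∣_; divides; ∣⇒≤)
open import Data.Nat.Primality using (Prime; euclidsLemma; prime⇒nonZero; prime⇒nonTrivial)
open import Data.Nat.Coprimality using (coprime-Bézout; prime⇒coprime)
open import Data.Nat.GCD using (module Bézout)
open import Data.Nat.DivMod using (_mod_; _divMod_; DivMod; m<n⇒m%n≡m)
open import Data.Fin as Fin using (Fin; toℕ; inject₁)
import Data.Fin.Properties as FinP
open import Data.Vec using (Vec; []; _∷_)
import Data.Vec.Functional as Vector
open import Data.Vec.Relation.Unary.All as All using (All; []; _∷_)
open import Data.Vec.Relation.Unary.Unique.Propositional using (Unique)
open import Data.Vec.Relation.Unary.AllPairs using ([]; _∷_)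
open import Data.Maybe using (Maybe; just; nothing)
open import Data.Integer as ℤ using (ℤ) renaming (+_ to pos; -[1+_] to negsuc)
import Data.Integer.Properties as ℤP
open import Data.Sign as Sign using (Sign)
open import Data.Product using (_×_; _,_; ∃; proj₁; proj₂)
open import Data.Sum using (inj₁; inj₂)
open import Data.Unit using (tt)
open import Data.Empty using (⊥-elim)
open import Relation.Nullary using (¬_; yes; no; contradiction)
open import Relation.Binary.PropositionalEquality
open import Algebra.Bundles using (CommutativeRing; RawRing)
open import Algebra.Solver.Ring.AlmostCommutativeRing using (fromCommutativeRing; _-Raw-AlmostCommutative⟶_)

module BinomialCoefficients where
  open import Data.Nat
  open import Data.Nat.Properties
  open import Data.Nat.Combinatorics using (nC1≡n; nCk+nC[k+1]≡[n+1]C[k+1])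
  open ≡-Reasoning

  absorption : ∀ n k → suc k * (suc n C suc k) ≡ suc n * (n C k)
  absorption zero zero = refl
  absorption zero (suc k) = *-zeroʳ (2 + k)
  absorption (suc n) zero = trans (+-identityʳ _) (trans (nC1≡n (2 + n)) (sym (*-identityʳ _)))
  absorption (suc n) (suc k) = begin
    (2 + k) * ((2 + n) C (2 + k))                    ≡⟨ cong ((2 + k) *_) (sym (nCk+nC[k+1]≡[n+1]C[k+1] (suc n) (suc k))) ⟩
    (2 + k) * (A + B)                                ≡⟨ *-distribˡ-+ (2 + k) A B ⟩
    (A + (1 + k) * A) + (2 + k) * B                  ≡⟨ cong₂ (λ u v → (A + u) + v) (absorption n k) (absorption n (suc k)) ⟩
    (A + (1 + n) * (n C k)) + (1 + n) * (n C suc k)  ≡⟨ +-assoc A _ _ ⟩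
    A + ((1 + n) * (n C k) + (1 + n) * (n C suc k))  ≡⟨ cong (A +_) (sym (*-distribˡ-+ (1 + n) (n C k) (n C suc k))) ⟩
    A + (1 + n) * (n C k + n C suc k)                ≡⟨ cong (λ z → A + (1 + n) * z) (nCk+nC[k+1]≡[n+1]C[k+1] n k) ⟩
    A + (1 + n) * A                                  ∎
    where
    A = suc n C suc k
    B = suc n C suc (suc k)

  -- p·C(p-1,k-1) = k·C(p,k), and p cannot divide the factor k < p.
  prime∣binomial : ∀ {p} → Prime p → ∀ k → 0 < k → k < p → p ∣ p C k
  prime∣binomial {suc n} p-prime (suc k) _ k<p
    with euclidsLemma (suc k) (suc n C suc k) p-prime
           (divides (n C k) (trans (absorption n k) (*-comm (suc n) (n C k))))
  ... | inj₁ p∣k = contradiction (∣⇒≤ p∣k) (<⇒≱ k<p)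
  ... | inj₂ p∣C = p∣C

module FieldArithmetic (𝕂 : Field) where
  open Field 𝕂
  open ≡-Reasoning

  commutativeRing : CommutativeRing 0ℓ 0ℓ
  commutativeRing = record { isCommutativeRing = isCommutativeRing }

  open CommutativeRing commutativeRing public
    using (+-comm; +-assoc; *-comm; *-assoc; distribˡ; distribʳ; +-identityˡ; +-identityʳ;
           *-identityˡ; *-identityʳ; -‿inverseʳ; zeroˡ; zeroʳ; ring)
  open import Algebra.Properties.Ring ring public
    using (-‿distribˡ-*; -‿distribʳ-*; -‿involutive; -0#≈0#; -‿+-comm)

  fromℕ-+ : ∀ m n → fromℕ 𝕂 (m ℕ.+ n) ≡ fromℕ 𝕂 m + fromℕ 𝕂 n
  fromℕ-+ zero n = sym (+-identityˡ _)
  fromℕ-+ (suc m) n = trans (cong (1# +_) (fromℕ-+ m n)) (sym (+-assoc _ _ _))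

  fromℕ-* : ∀ m n → fromℕ 𝕂 (m ℕ.* n) ≡ fromℕ 𝕂 m * fromℕ 𝕂 n
  fromℕ-* zero n = sym (zeroˡ _)
  fromℕ-* (suc m) n = begin
    fromℕ 𝕂 (n ℕ.+ m ℕ.* n)                       ≡⟨ fromℕ-+ n (m ℕ.* n) ⟩
    fromℕ 𝕂 n + fromℕ 𝕂 (m ℕ.* n)                 ≡⟨ cong₂ _+_ (sym (*-identityˡ _)) (fromℕ-* m n) ⟩
    1# * fromℕ 𝕂 n + fromℕ 𝕂 m * fromℕ 𝕂 n        ≡⟨ sym (distribʳ _ _ _) ⟩
    (1# + fromℕ 𝕂 m) * fromℕ 𝕂 n                  ∎

  -- The canonical map ℤ → 𝕂 is a ring homomorphism; it provides integer
  -- coefficients with decidable equality for the ring solver.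
  fromℤ : ℤ → Carrier
  fromℤ (pos n) = fromℕ 𝕂 n
  fromℤ (negsuc n) = - fromℕ 𝕂 (suc n)

  private
    applySign : Sign → Carrier → Carrier
    applySign Sign.+ x = x
    applySign Sign.- x = - x

    fromℤ-◃ : ∀ s n → fromℤ (s ℤ.◃ n) ≡ applySign s (fromℕ 𝕂 n)
    fromℤ-◃ Sign.+ zero = refl
    fromℤ-◃ Sign.- zero = sym -0#≈0#
    fromℤ-◃ Sign.+ (suc n) = refl
    fromℤ-◃ Sign.- (suc n) = refl

    fromℤ-signAbs : ∀ i → fromℤ i ≡ applySign (ℤ.sign i) (fromℕ 𝕂 ℤ.∣ i ∣)
    fromℤ-signAbs (pos n) = refl
    fromℤ-signAbs (negsuc n) = refl

    applySign-* : ∀ s t x y → applySign (s Sign.* t) (x * y) ≡ applySign s x * applySign t y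
    applySign-* Sign.+ Sign.+ x y = refl
    applySign-* Sign.+ Sign.- x y = -‿distribʳ-* x y
    applySign-* Sign.- Sign.+ x y = -‿distribˡ-* x y
    applySign-* Sign.- Sign.- x y = sym (begin
      - x * - y      ≡⟨ sym (-‿distribˡ-* x (- y)) ⟩
      - (x * - y)    ≡⟨ cong -_ (sym (-‿distribʳ-* x y)) ⟩
      - - (x * y)    ≡⟨ -‿involutive _ ⟩
      x * y          ∎)

    fromℤ-⊖ : ∀ m n → fromℤ (m ℤ.⊖ n) ≡ fromℕ 𝕂 m + - fromℕ 𝕂 n
    fromℤ-⊖ zero zero = sym (trans (+-identityˡ _) -0#≈0#)
    fromℤ-⊖ zero (suc n) = sym (+-identityˡ _)
    fromℤ-⊖ (suc m) zero = sym (trans (cong (fromℕ 𝕂 (suc m) +_) -0#≈0#) (+-identityʳ _))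
    fromℤ-⊖ (suc m) (suc n) = begin
      fromℤ (suc m ℤ.⊖ suc n)          ≡⟨ cong fromℤ (ℤP.[1+m]⊖[1+n]≡m⊖n m n) ⟩
      fromℤ (m ℤ.⊖ n)                  ≡⟨ fromℤ-⊖ m n ⟩
      a + - b                          ≡⟨ cong (_+ - b) (sym (+-identityˡ a)) ⟩
      (0# + a) + - b                   ≡⟨ cong (λ z → (z + a) + - b) (sym (-‿inverseʳ 1#)) ⟩
      ((1# + - 1#) + a) + - b          ≡⟨ cong (_+ - b) (+-assoc 1# (- 1#) a) ⟩
      (1# + (- 1# + a)) + - b          ≡⟨ cong (λ z → (1# + z) + - b) (+-comm (- 1#) a) ⟩
      (1# + (a + - 1#)) + - b          ≡⟨ cong (_+ - b) (sym (+-assoc 1# a (- 1#))) ⟩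
      ((1# + a) + - 1#) + - b          ≡⟨ +-assoc (1# + a) (- 1#) (- b) ⟩
      (1# + a) + (- 1# + - b)          ≡⟨ cong ((1# + a) +_) (-‿+-comm 1# b) ⟩
      (1# + a) + - (1# + b)            ∎
      where a = fromℕ 𝕂 m ; b = fromℕ 𝕂 n

  fromℤ-* : ∀ i j → fromℤ (i ℤ.* j) ≡ fromℤ i * fromℤ j
  fromℤ-* i j = begin
    fromℤ (i ℤ.* j)                                          ≡⟨ fromℤ-◃ (s Sign.* t) (ℤ.∣ i ∣ ℕ.* ℤ.∣ j ∣) ⟩
    applySign (s Sign.* t) (fromℕ 𝕂 (ℤ.∣ i ∣ ℕ.* ℤ.∣ j ∣))  ≡⟨ cong (applySign (s Sign.* t)) (fromℕ-* ℤ.∣ i ∣ ℤ.∣ j ∣) ⟩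
    applySign (s Sign.* t) (fromℕ 𝕂 ℤ.∣ i ∣ * fromℕ 𝕂 ℤ.∣ j ∣) ≡⟨ applySign-* s t _ _ ⟩
    applySign s (fromℕ 𝕂 ℤ.∣ i ∣) * applySign t (fromℕ 𝕂 ℤ.∣ j ∣) ≡⟨ sym (cong₂ _*_ (fromℤ-signAbs i) (fromℤ-signAbs j)) ⟩
    fromℤ i * fromℤ j                                        ∎
    where s = ℤ.sign i ; t = ℤ.sign j

  fromℤ-neg : ∀ i → fromℤ (ℤ.- i) ≡ - fromℤ i
  fromℤ-neg (pos zero) = sym -0#≈0#
  fromℤ-neg (pos (suc n)) = refl
  fromℤ-neg (negsuc n) = sym (-‿involutive _)

  fromℤ-+ : ∀ i j → fromℤ (i ℤ.+ j) ≡ fromℤ i + fromℤ j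
  fromℤ-+ (negsuc m) (negsuc n) = begin
    - fromℕ 𝕂 (suc (suc (m ℕ.+ n)))                  ≡⟨ cong (λ z → - fromℕ 𝕂 (suc z)) (sym (ℕP.+-suc m n)) ⟩
    - fromℕ 𝕂 (suc m ℕ.+ suc n)                      ≡⟨ cong -_ (fromℕ-+ (suc m) (suc n)) ⟩
    - (fromℕ 𝕂 (suc m) + fromℕ 𝕂 (suc n))            ≡⟨ sym (-‿+-comm _ _) ⟩
    - fromℕ 𝕂 (suc m) + - fromℕ 𝕂 (suc n)            ∎
  fromℤ-+ (negsuc m) (pos n) = trans (fromℤ-⊖ n (suc m)) (+-comm _ _)
  fromℤ-+ (pos m) (negsuc n) = fromℤ-⊖ m (suc n)
  fromℤ-+ (pos m) (pos n) = fromℕ-+ m n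

  private
    integers : RawRing 0ℓ 0ℓ
    integers = record { Carrier = ℤ ; _≈_ = _≡_ ; _+_ = ℤ._+_ ; _*_ = ℤ._*_ ; -_ = ℤ.-_ ; 0# = pos 0 ; 1# = pos 1 }

    almostCommutativeRing = fromCommutativeRing commutativeRing

    fromℤ-homomorphism : integers -Raw-AlmostCommutative⟶ almostCommutativeRing
    fromℤ-homomorphism = record
      { ⟦_⟧ = fromℤ ; +-homo = fromℤ-+ ; *-homo = fromℤ-* ; -‿homo = fromℤ-neg
      ; 0-homo = refl ; 1-homo = +-identityʳ 1# }

    coefficient-equality : ∀ i j → Maybe (fromℤ i ≡ fromℤ j)
    coefficient-equality i j with i ℤ.≟ j
    ... | yes refl = just refl
    ... | no _ = nothing

  open import Algebra.Solver.Ring integers almostCommutativeRing fromℤ-homomorphism coefficient-equality public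
    using (solve; _:=_; _:+_; _:*_; :-_; con)

  pow-* : ∀ x y n → pow 𝕂 (x * y) n ≡ pow 𝕂 x n * pow 𝕂 y n
  pow-* x y zero = sym (*-identityʳ 1#)
  pow-* x y (suc n) = trans (cong ((x * y) *_) (pow-* x y n))
    (solve 4 (λ x y u v → (x :* y) :* (u :* v) := (x :* u) :* (y :* v)) refl x y (pow 𝕂 x n) (pow 𝕂 y n))

  pow-1# : ∀ n → pow 𝕂 1# n ≡ 1#
  pow-1# zero = refl
  pow-1# (suc n) = trans (*-identityˡ _) (pow-1# n)

  1≢0 : 1# ≢ 0#
  1≢0 e = 0≢1 (sym e)

  inverseˡ : ∀ x → x ≢ 0# → x ⁻¹ * x ≡ 1#
  inverseˡ x x≢0 = trans (*-comm _ _) (inverseʳ x x≢0)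

  ⁻¹-nonzero : ∀ {x} → x ≢ 0# → x ⁻¹ ≢ 0#
  ⁻¹-nonzero {x} x≢0 e = 1≢0 (trans (sym (inverseʳ x x≢0)) (trans (cong (x *_) e) (zeroʳ x)))

  ⁻¹-involutive : ∀ {x} → x ≢ 0# → (x ⁻¹) ⁻¹ ≡ x
  ⁻¹-involutive {x} x≢0 = begin
    (x ⁻¹) ⁻¹                 ≡⟨ sym (*-identityˡ _) ⟩
    1# * (x ⁻¹) ⁻¹            ≡⟨ cong (_* (x ⁻¹) ⁻¹) (sym (inverseʳ x x≢0)) ⟩
    (x * x ⁻¹) * (x ⁻¹) ⁻¹    ≡⟨ *-assoc _ _ _ ⟩
    x * (x ⁻¹ * (x ⁻¹) ⁻¹)    ≡⟨ cong (x *_) (inverseʳ (x ⁻¹) (⁻¹-nonzero x≢0)) ⟩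
    x * 1#                    ≡⟨ *-identityʳ x ⟩
    x                         ∎

  cancel-inverse : ∀ {x} → x ≢ 0# → ∀ y → x * (x ⁻¹ * y) ≡ y
  cancel-inverse {x} x≢0 y = trans (sym (*-assoc _ _ _)) (trans (cong (_* y) (inverseʳ x x≢0)) (*-identityˡ y))

  cancel-inverse′ : ∀ {x} → x ≢ 0# → ∀ y → x ⁻¹ * (x * y) ≡ y
  cancel-inverse′ {x} x≢0 y = trans (sym (*-assoc _ _ _)) (trans (cong (_* y) (inverseˡ x x≢0)) (*-identityˡ y))

  *-cancelˡ-nonzero : ∀ {a x y} → a ≢ 0# → a * x ≡ a * y → x ≡ y
  *-cancelˡ-nonzero {a} {x} {y} a≢0 ax≡ay = begin
    x                ≡⟨ sym (cancel-inverse′ a≢0 x) ⟩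
    a ⁻¹ * (a * x)   ≡⟨ cong (a ⁻¹ *_) ax≡ay ⟩
    a ⁻¹ * (a * y)   ≡⟨ cancel-inverse′ a≢0 y ⟩
    y                ∎

  no-zero-divisors : ∀ {a b} → a ≢ 0# → a * b ≡ 0# → b ≡ 0#
  no-zero-divisors {a} a≢0 ab≡0 = *-cancelˡ-nonzero a≢0 (trans ab≡0 (sym (zeroʳ a)))

  difference-zero : ∀ {x y} → x + - y ≡ 0# → x ≡ y
  difference-zero {x} {y} e = begin
    x              ≡⟨ solve 2 (λ x y → x := (x :+ :- y) :+ y) refl x y ⟩
    (x + - y) + y  ≡⟨ cong (_+ y) e ⟩
    0# + y         ≡⟨ +-identityˡ y ⟩
    y              ∎

  sum-cong : ∀ n {f g : Fin n → Carrier} → (∀ i → f i ≡ g i) → sumFin 𝕂 n f ≡ sumFin 𝕂 n g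
  sum-cong zero h = refl
  sum-cong (suc n) h = cong₂ _+_ (h Fin.zero) (sum-cong n (λ i → h (Fin.suc i)))

  sum-zero : ∀ n {f : Fin n → Carrier} → (∀ i → f i ≡ 0#) → sumFin 𝕂 n f ≡ 0#
  sum-zero zero h = refl
  sum-zero (suc n) h = trans (cong₂ _+_ (h Fin.zero) (sum-zero n (λ i → h (Fin.suc i)))) (+-identityˡ 0#)

  sum-scale : ∀ n c (f : Fin n → Carrier) → c * sumFin 𝕂 n f ≡ sumFin 𝕂 n (λ i → c * f i)
  sum-scale zero c f = zeroʳ c
  sum-scale (suc n) c f = trans (distribˡ c _ _) (cong (c * f Fin.zero +_) (sum-scale n c (λ i → f (Fin.suc i))))

  sum-difference : ∀ n (f g : Fin n → Carrier) →
                   sumFin 𝕂 n f + - sumFin 𝕂 n g ≡ sumFin 𝕂 n (λ i → f i + - g i)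
  sum-difference zero f g = trans (cong (0# +_) -0#≈0#) (+-identityˡ 0#)
  sum-difference (suc n) f g = trans
    (solve 4 (λ a b u v → (a :+ u) :+ :- (b :+ v) := (a :+ :- b) :+ (u :+ :- v)) refl (f Fin.zero) (g Fin.zero) _ _)
    (cong ((f Fin.zero + - g Fin.zero) +_) (sum-difference n (λ i → f (Fin.suc i)) (λ i → g (Fin.suc i))))

-- Polynomials given by coefficient vectors c₀ ∷ c₁ ∷ … ∷ cₙ₋₁ (lowest degree
-- first), evaluated by Horner's rule.
module PolynomialRoots (𝕂 : Field) where
  open Field 𝕂
  open FieldArithmetic 𝕂
  open ≡-Reasoning

  evalCoeffs : ∀ {n} → Vec Carrier n → Carrier → Carrier
  evalCoeffs [] x = 0#
  evalCoeffs (c ∷ cs) x = c + x * evalCoeffs cs x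

  IsZero : ∀ {n} → Vec Carrier n → Set
  IsZero = All (_≡ 0#)

  evalCoeffs-zero : ∀ {n} {P : Vec Carrier n} x → IsZero P → evalCoeffs P x ≡ 0#
  evalCoeffs-zero x [] = refl
  evalCoeffs-zero x (c≡0 ∷ cs≡0) =
    trans (cong₂ (λ c v → c + x * v) c≡0 (evalCoeffs-zero x cs≡0)) (trans (+-identityˡ _) (zeroʳ x))

  quotient : ∀ {n} → Carrier → Vec Carrier (suc n) → Vec Carrier n
  quotient r (c ∷ []) = []
  quotient r (c ∷ c₁ ∷ cs) = evalCoeffs (c₁ ∷ cs) r ∷ quotient r (c₁ ∷ cs)

  division : ∀ {n} r (P : Vec Carrier (suc n)) x →
             evalCoeffs P x ≡ evalCoeffs P r + (x + - r) * evalCoeffs (quotient r P) x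
  division r (c ∷ []) x =
    solve 3 (λ c r x → c :+ x :* con (pos 0) := (c :+ r :* con (pos 0)) :+ (x :+ :- r) :* con (pos 0)) refl c r x
  division r (c ∷ c₁ ∷ cs) x = begin
    c + x * Q x                        ≡⟨ cong (λ z → c + x * z) (division r (c₁ ∷ cs) x) ⟩
    c + x * (Q r + (x + - r) * D x)    ≡⟨ solve 5 (λ c x r q d → c :+ x :* (q :+ (x :+ :- r) :* d)
                                                  := (c :+ r :* q) :+ (x :+ :- r) :* (q :+ x :* d)) refl c x r (Q r) (D x) ⟩
    (c + r * Q r) + (x + - r) * (Q r + x * D x) ∎
    where
    Q = evalCoeffs (c₁ ∷ cs)
    D = evalCoeffs (quotient r (c₁ ∷ cs))

  quotient-zero : ∀ {n} r c (cs : Vec Carrier n) → IsZero (quotient r (c ∷ cs)) → IsZero cs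
  quotient-zero r c [] _ = []
  quotient-zero r c (c₁ ∷ cs) (q≡0 ∷ qs≡0) = c₁≡0 ∷ cs≡0
    where
    cs≡0 = quotient-zero r c₁ cs qs≡0
    c₁≡0 : c₁ ≡ 0#
    c₁≡0 = trans (sym (trans (cong (λ v → c₁ + r * v) (evalCoeffs-zero r cs≡0))
                             (trans (cong (c₁ +_) (zeroʳ r)) (+-identityʳ c₁)))) q≡0

  quotient-root : ∀ {n} {r s} (P : Vec Carrier (suc n)) → r ≢ s →
                  evalCoeffs P r ≡ 0# → evalCoeffs P s ≡ 0# → evalCoeffs (quotient r P) s ≡ 0#
  quotient-root {r = r} {s} P r≢s Pr≡0 Ps≡0 = no-zero-divisors s-r≢0 (begin
    (s + - r) * evalCoeffs (quotient r P) s        ≡⟨ sym (+-identityˡ _) ⟩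
    0# + (s + - r) * evalCoeffs (quotient r P) s   ≡⟨ cong (_+ (s + - r) * evalCoeffs (quotient r P) s) (sym Pr≡0) ⟩
    evalCoeffs P r + (s + - r) * evalCoeffs (quotient r P) s ≡⟨ sym (division r P s) ⟩
    evalCoeffs P s                                 ≡⟨ Ps≡0 ⟩
    0#                                             ∎)
    where
    s-r≢0 : s + - r ≢ 0#
    s-r≢0 e = r≢s (sym (difference-zero e))

  roots⇒zero : ∀ {n} (P rs : Vec Carrier n) → Unique rs → All (λ r → evalCoeffs P r ≡ 0#) rs → IsZero P
  roots⇒zero [] [] _ _ = []
  roots⇒zero (c ∷ cs) (r ∷ rs) (r∉rs ∷ rs-unique) (Pr≡0 ∷ Prs≡0) = c≡0 ∷ cs≡0
    where
    Q-roots : All (λ s → evalCoeffs (quotient r (c ∷ cs)) s ≡ 0#) rs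
    Q-roots = All.map (λ (r≢s , Ps≡0) → quotient-root (c ∷ cs) r≢s Pr≡0 Ps≡0) (All.zip (r∉rs , Prs≡0))
    cs≡0 : IsZero cs
    cs≡0 = quotient-zero r c cs (roots⇒zero (quotient r (c ∷ cs)) rs rs-unique Q-roots)
    c≡0 : c ≡ 0#
    c≡0 = trans (sym (trans (cong (λ v → c + r * v) (evalCoeffs-zero r cs≡0))
                            (trans (cong (c +_) (zeroʳ r)) (+-identityʳ c)))) Pr≡0

  monomial : ∀ n → Vec Carrier (suc n)
  monomial zero = 1# ∷ []
  monomial (suc n) = 0# ∷ monomial n

  evalCoeffs-monomial : ∀ n x → evalCoeffs (monomial n) x ≡ pow 𝕂 x n
  evalCoeffs-monomial zero x = trans (cong (1# +_) (zeroʳ x)) (+-identityʳ 1#)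
  evalCoeffs-monomial (suc n) x = trans (+-identityˡ _) (cong (x *_) (evalCoeffs-monomial n x))

  monomial-nonzero : ∀ n → ¬ IsZero (monomial n)
  monomial-nonzero zero (1≡0 ∷ _) = 1≢0 1≡0
  monomial-nonzero (suc n) (_ ∷ rest) = monomial-nonzero n rest

  at-most-m-fixed-points : ∀ m → 1 < m → (rs : Vec Carrier (suc m)) → Unique rs →
                           ¬ All (λ r → pow 𝕂 r m ≡ r) rs
  at-most-m-fixed-points (suc zero) (s≤s ()) _ _ _
  at-most-m-fixed-points (suc (suc q)) _ rs rs-unique fixed =
    monomial-nonzero q (drop-two (roots⇒zero Xᵐ-X rs rs-unique (All.map root fixed)))
    where
    Xᵐ-X : Vec Carrier (3 ℕ.+ q)
    Xᵐ-X = 0# ∷ - 1# ∷ monomial q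
    root : ∀ {r} → pow 𝕂 r (2 ℕ.+ q) ≡ r → evalCoeffs Xᵐ-X r ≡ 0#
    root {r} rᵐ≡r = begin
      0# + r * (- 1# + r * evalCoeffs (monomial q) r) ≡⟨ cong (λ z → 0# + r * (- 1# + r * z)) (evalCoeffs-monomial q r) ⟩
      0# + r * (- 1# + r * pow 𝕂 r q)                 ≡⟨ solve 3 (λ r o u → con (pos 0) :+ r :* (:- o :+ r :* u)
                                                                 := r :* (r :* u) :+ :- (r :* o)) refl r 1# (pow 𝕂 r q) ⟩
      pow 𝕂 r (2 ℕ.+ q) + - (r * 1#)                  ≡⟨ cong (λ z → pow 𝕂 r (2 ℕ.+ q) + - z) (*-identityʳ r) ⟩
      pow 𝕂 r (2 ℕ.+ q) + - r                         ≡⟨ cong (_+ - r) rᵐ≡r ⟩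
      r + - r                                          ≡⟨ -‿inverseʳ r ⟩
      0#                                               ∎
    drop-two : IsZero Xᵐ-X → IsZero (monomial q)
    drop-two (_ ∷ _ ∷ rest) = rest

-- The freshman's dream: (x + y)ⁿ = xⁿ + yⁿ when n is a prime with n·1 = 0,
-- since then every inner binomial coefficient C(n,k), 0 < k < n, vanishes.
module FreshmansDream (𝕂 : Field) where
  open Field 𝕂
  open FieldArithmetic 𝕂
  open ≡-Reasoning
  private
    semiring = CommutativeRing.semiring commutativeRing
  open import Algebra.Properties.CommutativeSemiring.Binomial (CommutativeRing.commutativeSemiring commutativeRing)
    using (theorem; binomialTerm)
  open import Algebra.Properties.Semiring.Mult semiring using () renaming (_×_ to _·_)
  open import Algebra.Properties.Semiring.Exp semiring using (_^_)
  open import Algebra.Definitions.RawMonoid (CommutativeRing.+-rawMonoid commutativeRing) using (sum)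

  pow≡^ : ∀ x n → pow 𝕂 x n ≡ x ^ n
  pow≡^ x zero = refl
  pow≡^ x (suc n) = cong (x *_) (pow≡^ x n)

  ·≡fromℕ* : ∀ n z → n · z ≡ fromℕ 𝕂 n * z
  ·≡fromℕ* zero z = sym (zeroˡ z)
  ·≡fromℕ* (suc n) z =
    trans (cong₂ _+_ (sym (*-identityˡ z)) (·≡fromℕ* n z)) (sym (distribʳ _ _ _))

  sum-last : ∀ {n} (t : Fin (suc n) → Carrier) → (∀ i → t (inject₁ i) ≡ 0#) → sum t ≡ t (Fin.fromℕ n)
  sum-last {zero} t _ = +-identityʳ _
  sum-last {suc n} t t≡0 =
    trans (cong (_+ sum (λ i → t (Fin.suc i))) (t≡0 Fin.zero))
          (trans (+-identityˡ _) (sum-last (λ i → t (Fin.suc i)) (λ i → t≡0 (Fin.suc i))))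

  freshman's-dream : ∀ n → Prime n → fromℕ 𝕂 n ≡ 0# → ∀ x y → pow 𝕂 (x + y) n ≡ pow 𝕂 x n + pow 𝕂 y n
  freshman's-dream zero n-prime _ = ⊥-elim (ℕ.≢-nonZero⁻¹ 0 {{prime⇒nonZero n-prime}} refl)
  freshman's-dream (suc q) n-prime n≡0 x y = begin
    pow 𝕂 (x + y) n                            ≡⟨ pow≡^ (x + y) n ⟩
    (x + y) ^ n                                ≡⟨ theorem n x y ⟩
    t Fin.zero + sum (λ i → t (Fin.suc i))     ≡⟨ cong (t Fin.zero +_) (sum-last (λ i → t (Fin.suc i)) inner) ⟩
    t Fin.zero + t (Fin.suc (Fin.fromℕ q))     ≡⟨ cong₂ _+_ first (last (toℕ (Fin.suc (Fin.fromℕ q))) (cong suc (FinP.toℕ-fromℕ q))) ⟩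
    y ^ n + x ^ n                              ≡⟨ +-comm _ _ ⟩
    x ^ n + y ^ n                              ≡⟨ sym (cong₂ _+_ (pow≡^ x n) (pow≡^ y n)) ⟩
    pow 𝕂 x n + pow 𝕂 y n                      ∎
    where
    n = suc q
    t = binomialTerm x y n
    first : t Fin.zero ≡ y ^ n
    first = trans (+-identityʳ _) (*-identityˡ _)
    last : ∀ k → k ≡ n → (n C k) · (x ^ k * y ^ (n ℕ.∸ k)) ≡ x ^ n
    last k refl rewrite nCn≡1 n | ℕP.n∸n≡0 n = trans (+-identityʳ _) (*-identityʳ _)
    inner-vanishes : ∀ k z → 0 < k → k < n → (n C k) · z ≡ 0#
    inner-vanishes k z 0<k k<n with BinomialCoefficients.prime∣binomial n-prime k 0<k k<n
    ... | divides m C≡m*n = begin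
      (n C k) · z                  ≡⟨ ·≡fromℕ* (n C k) z ⟩
      fromℕ 𝕂 (n C k) * z          ≡⟨ cong (λ w → fromℕ 𝕂 w * z) C≡m*n ⟩
      fromℕ 𝕂 (m ℕ.* n) * z        ≡⟨ cong (_* z) (fromℕ-* m n) ⟩
      (fromℕ 𝕂 m * fromℕ 𝕂 n) * z  ≡⟨ cong (λ w → (fromℕ 𝕂 m * w) * z) n≡0 ⟩
      (fromℕ 𝕂 m * 0#) * z         ≡⟨ cong (_* z) (zeroʳ _) ⟩
      0# * z                       ≡⟨ zeroˡ z ⟩
      0#                           ∎
    inner : ∀ i → t (Fin.suc (inject₁ i)) ≡ 0#
    inner i = inner-vanishes (suc (toℕ (inject₁ i))) _ (s≤s z≤n)
                (s≤s (subst (ℕ._< q) (sym (FinP.toℕ-inject₁ i)) (FinP.toℕ<n i)))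

module Characteristic (𝕂 : Field) (p : ℕ) (char : HasChar 𝕂 p) where
  open Field 𝕂
  open FieldArithmetic 𝕂
  open PolynomialRoots 𝕂
  open ≡-Reasoning

  p-prime : Prime p
  p-prime = proj₁ char

  p≡0 : fromℕ 𝕂 p ≡ 0#
  p≡0 = proj₂ char

  instance
    p-nonZero : NonZero p
    p-nonZero = prime⇒nonZero p-prime

  1<p : 1 < p
  1<p = ℕ.nonTrivial⇒n>1 p {{prime⇒nonTrivial p-prime}}

  multiple-of-zero : ∀ {m} k → fromℕ 𝕂 m ≡ 0# → fromℕ 𝕂 (k ℕ.* m) ≡ 0#
  multiple-of-zero {m} k m≡0 = trans (fromℕ-* k m) (trans (cong (fromℕ 𝕂 k *_) m≡0) (zeroʳ _))

  residue : ℕ → Fin p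
  residue m = m mod p

  toℕ-residue : ∀ {m} → m < p → toℕ (residue m) ≡ m
  toℕ-residue {m} m<p = trans (FinP.toℕ-fromℕ< _) (m<n⇒m%n≡m m<p)

  fromℕ-residue : ∀ m → fromℕ 𝕂 (toℕ (residue m)) ≡ fromℕ 𝕂 m
  fromℕ-residue m = sym (begin
    fromℕ 𝕂 m                                       ≡⟨ cong (fromℕ 𝕂) (DivMod.property (m divMod p)) ⟩
    fromℕ 𝕂 (toℕ (residue m) ℕ.+ q ℕ.* p)           ≡⟨ fromℕ-+ (toℕ (residue m)) (q ℕ.* p) ⟩
    fromℕ 𝕂 (toℕ (residue m)) + fromℕ 𝕂 (q ℕ.* p)   ≡⟨ cong (fromℕ 𝕂 (toℕ (residue m)) +_) (multiple-of-zero q p≡0) ⟩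
    fromℕ 𝕂 (toℕ (residue m)) + 0#                  ≡⟨ +-identityʳ _ ⟩
    fromℕ 𝕂 (toℕ (residue m))                       ∎)
    where q = DivMod.quotient (m divMod p)

  -- 1, …, p-1 are nonzero in 𝕂: a Bézout identity 1 + y·n = x·p (or
  -- 1 + x·p = y·n) would otherwise give 1 = 0.
  fromℕ-nonzero : ∀ {n} → 0 < n → n < p → fromℕ 𝕂 n ≢ 0#
  fromℕ-nonzero {n} 0<n n<p n≡0
    with coprime-Bézout (prime⇒coprime p-prime {{ℕ.>-nonZero 0<n}} n<p)
  ... | Bézout.+- x y eq = 1≢0 (begin
    1#                         ≡⟨ sym (one-plus-multiple y n≡0) ⟩
    fromℕ 𝕂 (1 ℕ.+ y ℕ.* n)    ≡⟨ cong (fromℕ 𝕂) eq ⟩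
    fromℕ 𝕂 (x ℕ.* p)          ≡⟨ multiple-of-zero x p≡0 ⟩
    0#                         ∎)
    where
    one-plus-multiple : ∀ {m} k → fromℕ 𝕂 m ≡ 0# → fromℕ 𝕂 (1 ℕ.+ k ℕ.* m) ≡ 1#
    one-plus-multiple k m≡0 = trans (cong (1# +_) (multiple-of-zero k m≡0)) (+-identityʳ 1#)
  ... | Bézout.-+ x y eq = 1≢0 (begin
    1#                         ≡⟨ sym (trans (cong (1# +_) (multiple-of-zero x p≡0)) (+-identityʳ 1#)) ⟩
    fromℕ 𝕂 (1 ℕ.+ x ℕ.* p)    ≡⟨ cong (fromℕ 𝕂) eq ⟩
    fromℕ 𝕂 (y ℕ.* n)          ≡⟨ multiple-of-zero y n≡0 ⟩
    0#                         ∎)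

  fromℕ-injective : ∀ {j m} → j < m → m < p → fromℕ 𝕂 j ≢ fromℕ 𝕂 m
  fromℕ-injective {j} {m} j<m m<p j≡m =
    fromℕ-nonzero (ℕP.m<n⇒0<n∸m j<m) (ℕP.≤-<-trans (ℕP.m∸n≤m m j) m<p) (begin
      fromℕ 𝕂 (m ℕ.∸ j)                              ≡⟨ solve 2 (λ a d → d := (a :+ d) :+ :- a) refl (fromℕ 𝕂 j) (fromℕ 𝕂 (m ℕ.∸ j)) ⟩
      (fromℕ 𝕂 j + fromℕ 𝕂 (m ℕ.∸ j)) + - fromℕ 𝕂 j  ≡⟨ cong (_+ - fromℕ 𝕂 j) (sym (fromℕ-+ j (m ℕ.∸ j))) ⟩
      fromℕ 𝕂 (j ℕ.+ (m ℕ.∸ j)) + - fromℕ 𝕂 j        ≡⟨ cong (λ z → fromℕ 𝕂 z + - fromℕ 𝕂 j) (ℕP.m+[n∸m]≡n (ℕP.<⇒≤ j<m)) ⟩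
      fromℕ 𝕂 m + - fromℕ 𝕂 j                        ≡⟨ cong (_+ - fromℕ 𝕂 j) (sym j≡m) ⟩
      fromℕ 𝕂 j + - fromℕ 𝕂 j                        ≡⟨ -‿inverseʳ _ ⟩
      0#                                              ∎)

  infix 30 _ᵖ
  _ᵖ : Carrier → Carrier
  x ᵖ = pow 𝕂 x p

  frobenius-+ : ∀ x y → (x + y) ᵖ ≡ x ᵖ + y ᵖ
  frobenius-+ = FreshmansDream.freshman's-dream 𝕂 p p-prime p≡0

  frobenius-0 : 0# ᵖ ≡ 0#
  frobenius-0 = trans (cong (pow 𝕂 0#) (sym (ℕP.suc-pred p))) (zeroˡ _)

  frobenius-neg : ∀ x → (- x) ᵖ ≡ - x ᵖ
  frobenius-neg x = begin
    (- x) ᵖ                   ≡⟨ solve 2 (λ a b → b := (a :+ b) :+ :- a) refl (x ᵖ) ((- x) ᵖ) ⟩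
    (x ᵖ + (- x) ᵖ) + - x ᵖ   ≡⟨ cong (_+ - x ᵖ) (sym (frobenius-+ x (- x))) ⟩
    (x + - x) ᵖ + - x ᵖ       ≡⟨ cong (λ z → z ᵖ + - x ᵖ) (-‿inverseʳ x) ⟩
    0# ᵖ + - x ᵖ              ≡⟨ cong (_+ - x ᵖ) frobenius-0 ⟩
    0# + - x ᵖ                ≡⟨ +-identityˡ _ ⟩
    - x ᵖ                     ∎

  frobenius-sum : ∀ n (f : Fin n → Carrier) → (sumFin 𝕂 n f) ᵖ ≡ sumFin 𝕂 n (λ i → f i ᵖ)
  frobenius-sum zero f = frobenius-0
  frobenius-sum (suc n) f =
    trans (frobenius-+ _ _) (cong (f Fin.zero ᵖ +_) (frobenius-sum n (λ i → f (Fin.suc i))))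

  fermat : ∀ n → (fromℕ 𝕂 n) ᵖ ≡ fromℕ 𝕂 n
  fermat zero = frobenius-0
  fermat (suc n) = trans (frobenius-+ 1# (fromℕ 𝕂 n)) (cong₂ _+_ (pow-1# p) (fermat n))

  -- Conversely every fixed point of Frobenius lies in the prime field: the p
  -- elements fromℕ 0, …, fromℕ (p-1) already exhaust the roots of Xᵖ - X.
  naturals : ∀ n → Vec Carrier n
  naturals zero = []
  naturals (suc n) = fromℕ 𝕂 n ∷ naturals n

  naturals-avoid : ∀ {x} n → (∀ m → m < n → x ≢ fromℕ 𝕂 m) → All (x ≢_) (naturals n)
  naturals-avoid zero _ = []
  naturals-avoid (suc n) x∉ = x∉ n ℕP.≤-refl ∷ naturals-avoid n (λ m m<n → x∉ m (ℕP.m<n⇒m<1+n m<n))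

  naturals-unique : ∀ n → n ≤ p → Unique (naturals n)
  naturals-unique zero _ = []
  naturals-unique (suc n) n<p =
    naturals-avoid n (λ m m<n n≡m → fromℕ-injective m<n n<p (sym n≡m)) ∷ naturals-unique n (ℕP.<⇒≤ n<p)

  naturals-fixed : ∀ n → All (λ r → r ᵖ ≡ r) (naturals n)
  naturals-fixed zero = []
  naturals-fixed (suc n) = fermat n ∷ naturals-fixed n

  frobenius-fixed : ∀ {w} → w ᵖ ≡ w → ¬ (∀ n → n < p → w ≢ fromℕ 𝕂 n)
  frobenius-fixed {w} w-fixed w∉ = at-most-m-fixed-points p 1<p (w ∷ naturals p)
    (naturals-avoid p w∉ ∷ naturals-unique p ℕP.≤-refl) (w-fixed ∷ naturals-fixed p)

  ℘ₚ : Carrier → Carrier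
  ℘ₚ = ℘ 𝕂 p

  ℘ₚ-+ : ∀ x y → ℘ₚ (x + y) ≡ ℘ₚ x + ℘ₚ y
  ℘ₚ-+ x y = trans (cong (_+ - (x + y)) (frobenius-+ x y))
    (solve 4 (λ a b x y → (a :+ b) :+ :- (x :+ y) := (a :+ :- x) :+ (b :+ :- y)) refl (x ᵖ) (y ᵖ) x y)

  ℘ₚ-neg : ∀ x → ℘ₚ (- x) ≡ - ℘ₚ x
  ℘ₚ-neg x = trans (cong (_+ - (- x)) (frobenius-neg x))
    (solve 2 (λ a x → :- a :+ :- (:- x) := :- (a :+ :- x)) refl (x ᵖ) x)

  combination : ∀ {n} → (Fin n → Fin p) → (Fin n → Carrier) → Carrier
  combination {n} c v = sumFin 𝕂 n (λ i → fromℕ 𝕂 (toℕ (c i)) * v i)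

  combination-cong : ∀ {n} (c : Fin n → Fin p) {v w} → (∀ i → v i ≡ w i) → combination c v ≡ combination c w
  combination-cong {n} c v≡w = sum-cong n (λ i → cong (fromℕ 𝕂 (toℕ (c i)) *_) (v≡w i))

  combination-scale : ∀ {n} (c : Fin n → Fin p) x v → x * combination c v ≡ combination c (λ i → x * v i)
  combination-scale {n} c x v = trans (sum-scale n x _)
    (sum-cong n (λ i → solve 3 (λ x c v → x :* (c :* v) := c :* (x :* v)) refl x (fromℕ 𝕂 (toℕ (c i))) (v i)))

  combination-difference : ∀ {n} (c : Fin n → Fin p) v w →
                           combination c v + - combination c w ≡ combination c (λ i → v i + - w i)
  combination-difference {n} c v w = trans (sum-difference n _ _)
    (sum-cong n (λ i → solve 3 (λ c v w → c :* v :+ :- (c :* w) := c :* (v :+ :- w)) refl (fromℕ 𝕂 (toℕ (c i))) (v i) (w i)))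

  frobenius-combination : ∀ {n} (c : Fin n → Fin p) v → (combination c v) ᵖ ≡ combination c (λ i → v i ᵖ)
  frobenius-combination {n} c v = trans (frobenius-sum n _)
    (sum-cong n (λ i → trans (pow-* _ _ p) (cong (_* v i ᵖ) (fermat (toℕ (c i))))))

  indicator : ∀ {n} → Fin n → Fin n → Fin p
  indicator Fin.zero Fin.zero = residue 1
  indicator Fin.zero (Fin.suc _) = residue 0
  indicator (Fin.suc _) Fin.zero = residue 0
  indicator (Fin.suc j) (Fin.suc i) = indicator j i

  indicator-diagonal : ∀ {n} (j : Fin n) → toℕ (indicator j j) ≡ 1
  indicator-diagonal Fin.zero = toℕ-residue 1<p
  indicator-diagonal (Fin.suc j) = indicator-diagonal j

  weight-zero : ∀ x → fromℕ 𝕂 (toℕ (residue 0)) * x ≡ 0#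
  weight-zero x = trans (cong (λ m → fromℕ 𝕂 m * x) (toℕ-residue (ℕP.<-trans (s≤s z≤n) 1<p))) (zeroˡ x)

  combination-indicator : ∀ {n} (j : Fin n) v → combination (indicator j) v ≡ v j
  combination-indicator {suc n} Fin.zero v =
    trans (cong₂ _+_ weight-one (sum-zero n (λ i → weight-zero (v (Fin.suc i))))) (+-identityʳ _)
    where
    weight-one : fromℕ 𝕂 (toℕ (residue 1)) * v Fin.zero ≡ v Fin.zero
    weight-one = trans (cong (λ m → fromℕ 𝕂 m * v Fin.zero) (toℕ-residue 1<p))
                       (trans (cong (_* v Fin.zero) (+-identityʳ 1#)) (*-identityˡ _))
  combination-indicator {suc n} (Fin.suc j) v =
    trans (cong₂ _+_ (weight-zero (v Fin.zero)) (combination-indicator j (λ i → v (Fin.suc i)))) (+-identityˡ _)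


module PolynomialMaps (𝕂 : Field) where
  open Field 𝕂

  powPoly : ∀ {m} → Poly 𝕂 m → ℕ → Poly 𝕂 m
  powPoly P zero = con 1#
  powPoly P (suc n) = P ⊗ powPoly P n

  ℘Poly : ∀ {m} → ℕ → Poly 𝕂 m → Poly 𝕂 m
  ℘Poly q P = powPoly P q ⊕ (⊝ P)

  eval-powPoly : ∀ {m} v (P : Poly 𝕂 m) n → eval 𝕂 v (powPoly P n) ≡ pow 𝕂 (eval 𝕂 v P) n
  eval-powPoly v P zero = refl
  eval-powPoly v P (suc n) = cong (eval 𝕂 v P *_) (eval-powPoly v P n)

  eval-℘Poly : ∀ {m} q v (P : Poly 𝕂 m) → eval 𝕂 v (℘Poly q P) ≡ ℘ 𝕂 q (eval 𝕂 v P)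
  eval-℘Poly q v P = cong (_+ - eval 𝕂 v P) (eval-powPoly v P q)

  eval-cong : ∀ {m} {v w : Fin m → Carrier} P → (∀ i → v i ≡ w i) → eval 𝕂 v P ≡ eval 𝕂 w P
  eval-cong (var i) v≡w = v≡w i
  eval-cong (con c) v≡w = refl
  eval-cong (P ⊕ Q) v≡w = cong₂ _+_ (eval-cong P v≡w) (eval-cong Q v≡w)
  eval-cong (P ⊗ Q) v≡w = cong₂ _*_ (eval-cong P v≡w) (eval-cong Q v≡w)
  eval-cong (⊝ P) v≡w = cong -_ (eval-cong P v≡w)

  substitute : ∀ {m n} → (Fin m → Poly 𝕂 n) → Poly 𝕂 m → Poly 𝕂 n
  substitute σ (var i) = σ i
  substitute σ (con c) = con c
  substitute σ (P ⊕ Q) = substitute σ P ⊕ substitute σ Q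
  substitute σ (P ⊗ Q) = substitute σ P ⊗ substitute σ Q
  substitute σ (⊝ P) = ⊝ substitute σ P

  eval-substitute : ∀ {m n} (σ : Fin m → Poly 𝕂 n) v P →
                    eval 𝕂 v (substitute σ P) ≡ eval 𝕂 (λ i → eval 𝕂 v (σ i)) P
  eval-substitute σ v (var i) = refl
  eval-substitute σ v (con c) = refl
  eval-substitute σ v (P ⊕ Q) = cong₂ _+_ (eval-substitute σ v P) (eval-substitute σ v Q)
  eval-substitute σ v (P ⊗ Q) = cong₂ _*_ (eval-substitute σ v P) (eval-substitute σ v Q)
  eval-substitute σ v (⊝ P) = cong -_ (eval-substitute σ v P)

  substitute-over : ∀ {S} {m n} (σ : Fin m → Poly 𝕂 n) P →
                    (∀ i → DefinedOver 𝕂 S (σ i)) → DefinedOver 𝕂 S P → DefinedOver 𝕂 S (substitute σ P)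
  substitute-over σ (var i) σ-over _ = σ-over i
  substitute-over σ (con c) _ c∈S = c∈S
  substitute-over σ (P ⊕ Q) σ-over (P-over , Q-over) = substitute-over σ P σ-over P-over , substitute-over σ Q σ-over Q-over
  substitute-over σ (P ⊗ Q) σ-over (P-over , Q-over) = substitute-over σ P σ-over P-over , substitute-over σ Q σ-over Q-over
  substitute-over σ (⊝ P) σ-over P-over = substitute-over σ P σ-over P-over

  eval-over : ∀ {S T : Carrier → Set} → IsSubfield 𝕂 T → (∀ {x} → S x → T x) →
              ∀ {m} (v : Fin m → Carrier) P → DefinedOver 𝕂 S P → (∀ i → T (v i)) → T (eval 𝕂 v P)
  eval-over T-subfield S⊆T v (var i) _ v∈T = v∈T i
  eval-over T-subfield S⊆T v (con c) c∈S _ = S⊆T c∈S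
  eval-over T-subfield S⊆T v (P ⊕ Q) (P-over , Q-over) v∈T =
    IsSubfield.+∈ T-subfield (eval-over T-subfield S⊆T v P P-over v∈T) (eval-over T-subfield S⊆T v Q Q-over v∈T)
  eval-over T-subfield S⊆T v (P ⊗ Q) (P-over , Q-over) v∈T =
    IsSubfield.*∈ T-subfield (eval-over T-subfield S⊆T v P P-over v∈T) (eval-over T-subfield S⊆T v Q Q-over v∈T)
  eval-over T-subfield S⊆T v (⊝ P) P-over v∈T = IsSubfield.-∈ T-subfield (eval-over T-subfield S⊆T v P P-over v∈T)

  module _ {S : Carrier → Set} (S-subfield : IsSubfield 𝕂 S) where
    open IsSubfield S-subfield

    powPoly-over : ∀ {m} (P : Poly 𝕂 m) n → DefinedOver 𝕂 S P → DefinedOver 𝕂 S (powPoly P n)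
    powPoly-over P zero _ = 1∈
    powPoly-over P (suc n) P-over = P-over , powPoly-over P n P-over

    ℘Poly-over : ∀ {m} q (P : Poly 𝕂 m) → DefinedOver 𝕂 S P → DefinedOver 𝕂 S (℘Poly q P)
    ℘Poly-over q P P-over = powPoly-over P q P-over , P-over

-- Let a = (a₀, A₀, …, Aₘ)
-- be nonzero and β₀, …, βₘ ∈ k with Aⱼ βⱼᵖ = a₀ and βⱼᵖ ≠ βⱼ.  Put
-- eⱼ = βⱼ - βⱼᵖ ≠ 0 and a′ⱼ = eⱼ⁻¹.  Then G_{a′} ≅ G_a over k via
--   (Y₀, …, Yₘ) ↦ (X, Y₀ + β₀X, …, Yₘ + βₘX),  where X = a′₀ ℘(Y₀),
--   (v₀, v₁, …, vₘ₊₁) ↦ (v₁ - β₀v₀, …, vₘ₊₁ - βₘv₀),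
-- so an isomorphism G_{a′} ≅ 𝔾ₐ over k yields one for G_a.
module Lift (𝕂 : Field) (p : ℕ) (char : HasChar 𝕂 p)
            (k : Field.Carrier 𝕂 → Set) (k-subfield : IsSubfield 𝕂 k) where
  open Field 𝕂
  open FieldArithmetic 𝕂
  open Characteristic 𝕂 p char
  open PolynomialMaps 𝕂
  open IsSubfield k-subfield
  open ≡-Reasoning

  pow∈k : ∀ {x} n → k x → k (pow 𝕂 x n)
  pow∈k zero _ = 1∈
  pow∈k (suc n) x∈k = *∈ x∈k (pow∈k n x∈k)

  module Lifting {m : ℕ} (a : Fin (suc (suc m)) → Carrier) (a≢0 : ∀ i → a i ≢ 0#)
                 (β : Fin (suc m) → Carrier) (β∈k : ∀ j → k (β j))
                 (β-root : ∀ j → a (Fin.suc j) * β j ᵖ ≡ a Fin.zero) (β-moved : ∀ j → β j ᵖ ≢ β j) where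
    a₀ : Carrier
    a₀ = a Fin.zero

    A : Fin (suc m) → Carrier
    A j = a (Fin.suc j)

    e : Fin (suc m) → Carrier
    e j = β j + - β j ᵖ

    e≢0 : ∀ j → e j ≢ 0#
    e≢0 j e≡0 = β-moved j (sym (difference-zero e≡0))

    e∈k : ∀ j → k (e j)
    e∈k j = +∈ (β∈k j) (-∈ (pow∈k p (β∈k j)))

    a′ : Fin (suc m) → Carrier
    a′ j = e j ⁻¹

    a′∈k : ∀ j → k (a′ j)
    a′∈k j = ⁻¹∈ (e∈k j) (e≢0 j)

    -- If ℘(Y) = eⱼ X then a₀ ℘(X) = Aⱼ ℘(Y + βⱼ X):  ℘(Y + βⱼX) = βⱼᵖ ℘(X).
    ℘-shift : ∀ j {X Y} → ℘ₚ Y ≡ e j * X → a₀ * ℘ₚ X ≡ A j * ℘ₚ (Y + β j * X)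
    ℘-shift j {X} {Y} ℘Y≡eX = sym (begin
      A j * ℘ₚ (Y + β j * X)                          ≡⟨ cong (A j *_) (℘ₚ-+ Y (β j * X)) ⟩
      A j * (℘ₚ Y + ((β j * X) ᵖ + - (β j * X)))      ≡⟨ cong₂ (λ u v → A j * (u + (v + - (β j * X)))) ℘Y≡eX (pow-* (β j) X p) ⟩
      A j * (e j * X + (β j ᵖ * X ᵖ + - (β j * X)))   ≡⟨ solve 5 (λ A β b X q → A :* ((β :+ :- b) :* X :+ (b :* q :+ :- (β :* X)))
                                                                := (A :* b) :* (q :+ :- X)) refl (A j) (β j) (β j ᵖ) X (X ᵖ) ⟩
      (A j * β j ᵖ) * ℘ₚ X                            ≡⟨ cong (_* ℘ₚ X) (β-root j) ⟩
      a₀ * ℘ₚ X                                       ∎)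

    ℘-unshift : ∀ j {v₀ v} → a₀ * ℘ₚ v₀ ≡ A j * ℘ₚ v → ℘ₚ (v + - (β j * v₀)) ≡ e j * v₀
    ℘-unshift j {v₀} {v} a₀℘v₀≡Aj℘v = begin
      ℘ₚ (v + - (β j * v₀))                           ≡⟨ trans (℘ₚ-+ v _) (cong (℘ₚ v +_) (℘ₚ-neg (β j * v₀))) ⟩
      ℘ₚ v + - ((β j * v₀) ᵖ + - (β j * v₀))          ≡⟨ cong₂ (λ u w → u + - (w + - (β j * v₀))) ℘v (pow-* (β j) v₀ p) ⟩
      β j ᵖ * ℘ₚ v₀ + - (β j ᵖ * v₀ ᵖ + - (β j * v₀)) ≡⟨ solve 4 (λ b β x q → b :* (q :+ :- x) :+ :- (b :* q :+ :- (β :* x))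
                                                                := (β :+ :- b) :* x) refl (β j ᵖ) (β j) v₀ (v₀ ᵖ) ⟩
      e j * v₀                                         ∎
      where
      ℘v : ℘ₚ v ≡ β j ᵖ * ℘ₚ v₀
      ℘v = *-cancelˡ-nonzero (a≢0 (Fin.suc j)) (begin
        A j * ℘ₚ v                ≡⟨ sym a₀℘v₀≡Aj℘v ⟩
        a₀ * ℘ₚ v₀                ≡⟨ cong (_* ℘ₚ v₀) (sym (β-root j)) ⟩
        (A j * β j ᵖ) * ℘ₚ v₀     ≡⟨ *-assoc _ _ _ ⟩
        A j * (β j ᵖ * ℘ₚ v₀)     ∎)

    -- The two polynomial maps, built from those (f′, g′) of an isomorphism G_{a′} ≅ 𝔾ₐ.
    module Construction (f′ : Fin (suc m) → Poly 𝕂 1) (g′ : Poly 𝕂 (suc m)) where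
      Y : Fin (suc m) → Carrier → Carrier
      Y j x = eval 𝕂 (λ _ → x) (f′ j)

      X-poly : Poly 𝕂 1
      X-poly = con (a′ Fin.zero) ⊗ ℘Poly p (f′ Fin.zero)

      X : Carrier → Carrier
      X x = eval 𝕂 (λ _ → x) X-poly

      X≡ : ∀ x → X x ≡ a′ Fin.zero * ℘ₚ (Y Fin.zero x)
      X≡ x = cong (a′ Fin.zero *_) (eval-℘Poly p (λ _ → x) (f′ Fin.zero))

      f : Fin (suc (suc m)) → Poly 𝕂 1
      f Fin.zero = X-poly
      f (Fin.suc j) = f′ j ⊕ (con (β j) ⊗ X-poly)

      unshift : Fin (suc m) → Poly 𝕂 (suc (suc m))
      unshift j = var (Fin.suc j) ⊕ (⊝ (con (β j) ⊗ var Fin.zero))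

      g : Poly 𝕂 (suc (suc m))
      g = substitute unshift g′

      f-over : (∀ j → DefinedOver 𝕂 k (f′ j)) → ∀ i → DefinedOver 𝕂 k (f i)
      f-over f′-over Fin.zero = a′∈k Fin.zero , ℘Poly-over k-subfield p (f′ Fin.zero) (f′-over Fin.zero)
      f-over f′-over (Fin.suc j) = f′-over j , β∈k j , f-over f′-over Fin.zero

      g-over : DefinedOver 𝕂 k g′ → DefinedOver 𝕂 k g
      g-over = substitute-over unshift g′ (λ j → tt , β∈k j , tt)

      f-in-G : (∀ x → G 𝕂 p a′ (λ j → Y j x)) → ∀ x → G 𝕂 p a (λ i → eval 𝕂 (λ _ → x) (f i))
      f-in-G f′-in-G x Fin.zero = refl
      f-in-G f′-in-G x (Fin.suc j) = ℘-shift j ℘Y≡eX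
        where
        ℘Y≡eX : ℘ₚ (Y j x) ≡ e j * X x
        ℘Y≡eX = sym (trans (cong (e j *_) (trans (X≡ x) (f′-in-G x j))) (cancel-inverse (e≢0 j) _))

      f-additive : (∀ x y j → Y j (x + y) ≡ Y j x + Y j y) →
                   ∀ x y i → eval 𝕂 (λ _ → x + y) (f i) ≡ eval 𝕂 (λ _ → x) (f i) + eval 𝕂 (λ _ → y) (f i)
      f-additive Y-additive x y Fin.zero = X-additive
        where
        X-additive : X (x + y) ≡ X x + X y
        X-additive = begin
          X (x + y)                                              ≡⟨ X≡ (x + y) ⟩
          a′ Fin.zero * ℘ₚ (Y Fin.zero (x + y))                  ≡⟨ cong (λ z → a′ Fin.zero * ℘ₚ z) (Y-additive x y Fin.zero) ⟩
          a′ Fin.zero * ℘ₚ (Y Fin.zero x + Y Fin.zero y)         ≡⟨ cong (a′ Fin.zero *_) (℘ₚ-+ _ _) ⟩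
          a′ Fin.zero * (℘ₚ (Y Fin.zero x) + ℘ₚ (Y Fin.zero y))  ≡⟨ distribˡ _ _ _ ⟩
          a′ Fin.zero * ℘ₚ (Y Fin.zero x) + a′ Fin.zero * ℘ₚ (Y Fin.zero y) ≡⟨ sym (cong₂ _+_ (X≡ x) (X≡ y)) ⟩
          X x + X y                                              ∎
      f-additive Y-additive x y (Fin.suc j) =
        trans (cong₂ (λ s t → s + β j * t) (Y-additive x y j) (f-additive Y-additive x y Fin.zero))
              (solve 5 (λ y₁ y₂ b x₁ x₂ → (y₁ :+ y₂) :+ b :* (x₁ :+ x₂) := (y₁ :+ b :* x₁) :+ (y₂ :+ b :* x₂))
                     refl (Y j x) (Y j y) (β j) (X x) (X y))

      g∘f : (∀ x → eval 𝕂 (λ j → Y j x) g′ ≡ x) → ∀ x → eval 𝕂 (λ i → eval 𝕂 (λ _ → x) (f i)) g ≡ x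
      g∘f g′∘f′ x = trans (eval-substitute unshift _ g′) (trans (eval-cong g′ cancel) (g′∘f′ x))
        where
        cancel : ∀ j → (Y j x + β j * X x) + - (β j * X x) ≡ Y j x
        cancel j = solve 2 (λ y t → (y :+ t) :+ :- t := y) refl (Y j x) (β j * X x)

      f∘g : (∀ v → G 𝕂 p a′ v → ∀ j → Y j (eval 𝕂 v g′) ≡ v j) →
            ∀ v → G 𝕂 p a v → ∀ i → eval 𝕂 (λ _ → eval 𝕂 v g) (f i) ≡ v i
      f∘g f′∘g′ v v∈G = components
        where
        v₀ = v Fin.zero
        y : Fin (suc m) → Carrier
        y j = v (Fin.suc j) + - (β j * v₀)
        ℘y : ∀ j → ℘ₚ (y j) ≡ e j * v₀
        ℘y j = ℘-unshift j (v∈G (Fin.suc j))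
        -- a′ⱼ ℘(yⱼ) = v₀ for every j, so y ∈ G_{a′}
        a′℘y : ∀ j → a′ j * ℘ₚ (y j) ≡ v₀
        a′℘y j = trans (cong (a′ j *_) (℘y j)) (cancel-inverse′ (e≢0 j) v₀)
        u = eval 𝕂 v g
        Y≡y : ∀ j → Y j u ≡ y j
        Y≡y j = trans (cong (λ z → Y j z) (eval-substitute unshift v g′))
                      (f′∘g′ y (λ j → trans (a′℘y Fin.zero) (sym (a′℘y j))) j)
        X≡v₀ : X u ≡ v₀
        X≡v₀ = trans (X≡ u) (trans (cong (λ z → a′ Fin.zero * ℘ₚ z) (Y≡y Fin.zero)) (a′℘y Fin.zero))
        components : ∀ i → eval 𝕂 (λ _ → u) (f i) ≡ v i
        components Fin.zero = X≡v₀
        components (Fin.suc j) = trans (cong₂ (λ s t → s + β j * t) (Y≡y j) X≡v₀)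
          (solve 2 (λ w t → (w :+ :- t) :+ t := w) refl (v (Fin.suc j)) (β j * v₀))

    lift : IsoOverToGa 𝕂 p k a′ → IsoOverToGa 𝕂 p k a
    lift (f′ , g′ , f′-over , g′-over , f′-in-G , f′-additive , g′∘f′ , f′∘g′) =
      f , g , f-over f′-over , g-over g′-over , f-in-G f′-in-G , f-additive f′-additive , g∘f g′∘f′ , f∘g f′∘g′
      where open Construction f′ g′

module Reduction (𝕂 : Field) (p : ℕ) (char : HasChar 𝕂 p)
                 (k : Field.Carrier 𝕂 → Set) (k-subfield : IsSubfield 𝕂 k) (k-perfect : IsPerfect 𝕂 p k) where
  open Field 𝕂
  open FieldArithmetic 𝕂
  open Characteristic 𝕂 p char
  open Lift 𝕂 p char k k-subfield
  open IsSubfield k-subfield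
  open ≡-Reasoning

  record Admissible {n : ℕ} (a : Fin n → Carrier) : Set where
    field
      in-k : ∀ i → k (a i)
      nonzero : ∀ i → a i ≢ 0#
      independent : InvLinIndep 𝕂 p n a

  module Step {m : ℕ} (a : Fin (suc (suc m)) → Carrier) (admissible : Admissible a) where
    open Admissible admissible

    a₀ : Carrier
    a₀ = a Fin.zero

    A : Fin (suc m) → Carrier
    A j = a (Fin.suc j)

    b : Fin (suc m) → Carrier
    b j = a₀ * A j ⁻¹

    b∈k : ∀ j → k (b j)
    b∈k j = *∈ (in-k Fin.zero) (⁻¹∈ (in-k (Fin.suc j)) (nonzero (Fin.suc j)))

    β : Fin (suc m) → Carrier
    β j = proj₁ (k-perfect (b∈k j))

    β∈k : ∀ j → k (β j)
    β∈k j = proj₁ (proj₂ (k-perfect (b∈k j)))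

    βᵖ≡b : ∀ j → β j ᵖ ≡ b j
    βᵖ≡b j = proj₂ (proj₂ (k-perfect (b∈k j)))

    β-root : ∀ j → A j * β j ᵖ ≡ a₀
    β-root j = begin
      A j * β j ᵖ          ≡⟨ cong (A j *_) (βᵖ≡b j) ⟩
      A j * (a₀ * A j ⁻¹)  ≡⟨ solve 3 (λ x y z → x :* (y :* z) := y :* (x :* z)) refl (A j) a₀ (A j ⁻¹) ⟩
      a₀ * (A j * A j ⁻¹)  ≡⟨ cong (a₀ *_) (inverseʳ (A j) (nonzero (Fin.suc j))) ⟩
      a₀ * 1#              ≡⟨ *-identityʳ a₀ ⟩
      a₀                   ∎

    inverse-combination : ∀ c → combination c (λ j → A j ⁻¹) ≡ a₀ ⁻¹ * combination c (λ j → β j ᵖ)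
    inverse-combination c = sym (trans (combination-scale c (a₀ ⁻¹) (λ j → β j ᵖ))
      (combination-cong c (λ j → trans (cong (a₀ ⁻¹ *_) (βᵖ≡b j)) (cancel-inverse′ (nonzero Fin.zero) (A j ⁻¹)))))

    -- The key lemma: Σ cⱼ βⱼ = Σ cⱼ βⱼᵖ forces c = 0.  Indeed w = Σ cⱼ βⱼᵖ is
    -- then fixed by Frobenius, so w = n ∈ Fₚ, and (-n)/a₀ + Σ cⱼ/Aⱼ = (w - n)/a₀ = 0
    -- is an Fₚ-relation among the 1/aᵢ.
    β-independent : ∀ c → combination c β ≡ combination c (λ j → β j ᵖ) → ∀ j → toℕ (c j) ≡ 0
    β-independent c Σcβ≡Σcβᵖ j with toℕ (c j) ℕ.≟ 0
    ... | yes cⱼ≡0 = cⱼ≡0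
    ... | no cⱼ≢0 = ⊥-elim (frobenius-fixed w-fixed (λ n n<p w≡n → cⱼ≢0 (relation n n<p w≡n)))
      where
      w = combination c (λ j → β j ᵖ)
      w-fixed : w ᵖ ≡ w
      w-fixed = trans (cong _ᵖ (sym Σcβ≡Σcβᵖ)) (frobenius-combination c β)
      relation : ∀ n → n < p → w ≡ fromℕ 𝕂 n → toℕ (c j) ≡ 0
      relation n n<p w≡n = independent (residue (p ℕ.∸ n) Vector.∷ c) (begin
        fromℕ 𝕂 (toℕ (residue (p ℕ.∸ n))) * a₀ ⁻¹ + combination c (λ j → A j ⁻¹)
          ≡⟨ cong₂ (λ s t → s * a₀ ⁻¹ + t) (fromℕ-residue (p ℕ.∸ n)) (trans (inverse-combination c) (cong (a₀ ⁻¹ *_) w≡n)) ⟩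
        fromℕ 𝕂 (p ℕ.∸ n) * a₀ ⁻¹ + a₀ ⁻¹ * fromℕ 𝕂 n
          ≡⟨ solve 3 (λ x y u → x :* u :+ u :* y := (x :+ y) :* u) refl (fromℕ 𝕂 (p ℕ.∸ n)) (fromℕ 𝕂 n) (a₀ ⁻¹) ⟩
        (fromℕ 𝕂 (p ℕ.∸ n) + fromℕ 𝕂 n) * a₀ ⁻¹
          ≡⟨ cong (_* a₀ ⁻¹) (trans (sym (fromℕ-+ (p ℕ.∸ n) n)) (cong (fromℕ 𝕂) (ℕP.m∸n+n≡m (ℕP.<⇒≤ n<p)))) ⟩
        fromℕ 𝕂 p * a₀ ⁻¹
          ≡⟨ trans (cong (_* a₀ ⁻¹) p≡0) (zeroˡ _) ⟩
        0# ∎) (Fin.suc j)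

    β-moved : ∀ j → β j ᵖ ≢ β j
    β-moved j βⱼ-fixed = contradiction (β-independent (indicator j) Σβ≡Σβᵖ j) (λ e → ℕP.1+n≢0 (trans (sym (indicator-diagonal j)) e))
      where
      Σβ≡Σβᵖ : combination (indicator j) β ≡ combination (indicator j) (λ i → β i ᵖ)
      Σβ≡Σβᵖ = trans (combination-indicator j β) (trans (sym βⱼ-fixed) (sym (combination-indicator j (λ i → β i ᵖ))))

    open Lifting a nonzero β β∈k β-root β-moved public using (a′; lift)
    open Lifting a nonzero β β∈k β-root β-moved using (e; e≢0; a′∈k)

    -- a′ⱼ = eⱼ⁻¹ is admissible: Σ cⱼ eⱼ = Σ cⱼ βⱼ - Σ cⱼ βⱼᵖ, so a relation among
    -- the 1/a′ⱼ = eⱼ is exactly the situation of β-independent.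
    a′-admissible : Admissible a′
    a′-admissible = record
      { in-k = a′∈k
      ; nonzero = λ j → ⁻¹-nonzero (e≢0 j)
      ; independent = λ c Σce≡0 → β-independent c (difference-zero (begin
          combination c β + - combination c (λ j → β j ᵖ) ≡⟨ combination-difference c β (λ j → β j ᵖ) ⟩
          combination c e                                 ≡⟨ combination-cong c (λ j → sym (⁻¹-involutive (e≢0 j))) ⟩
          combination c (λ j → a′ j ⁻¹)                   ≡⟨ Σce≡0 ⟩
          0#                                              ∎))
      }

  iso-over-k : ∀ m (a : Fin (suc m) → Carrier) → Admissible a → IsoOverToGa 𝕂 p k a
  iso-over-k zero a _ =
    (λ _ → var Fin.zero) , var Fin.zero , (λ _ → tt) , tt ,
    (λ { x Fin.zero → refl }) , (λ { x y Fin.zero → refl }) , (λ x → refl) , (λ { v _ Fin.zero → refl })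
  iso-over-k (suc m) a admissible = lift (iso-over-k m a′ a′-admissible)
    where open Step a admissible

points : (𝕂 : Field) (p : ℕ) {k : Field.Carrier 𝕂 → Set} {m : ℕ} (a : Fin (suc m) → Field.Carrier 𝕂) →
         IsoOverToGa 𝕂 p k a → (K : Field.Carrier 𝕂 → Set) → IsSubfield 𝕂 K → (∀ {x} → k x → K x) →
         GroupIsoPoints 𝕂 p K a
points 𝕂 p a (f , g , f-over , g-over , f-in-G , f-additive , g∘f , f∘g) K K-subfield k⊆K =
  φ , φ-in-G , (λ {x} {y} _ _ → f-additive x y) , φ-injective , φ-surjective
  where
  open Field 𝕂
  open PolynomialMaps 𝕂
  φ : Carrier → Fin _ → Carrier
  φ x i = eval 𝕂 (λ _ → x) (f i)
  φ-in-G : ∀ {x} → K x → G 𝕂 p a (φ x) × (∀ i → K (φ x i))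
  φ-in-G {x} x∈K = f-in-G x , (λ i → eval-over K-subfield k⊆K (λ _ → x) (f i) (f-over i) (λ _ → x∈K))
  φ-injective : ∀ {x y} → K x → K y → (∀ i → φ x i ≡ φ y i) → x ≡ y
  φ-injective {x} {y} _ _ φx≡φy = trans (sym (g∘f x)) (trans (eval-cong g φx≡φy) (g∘f y))
  φ-surjective : ∀ v → G 𝕂 p a v → (∀ i → K (v i)) → ∃ λ x → K x × (∀ i → φ x i ≡ v i)
  φ-surjective v v∈G v∈K = eval 𝕂 v g , eval-over K-subfield k⊆K v g g-over v∈K , f∘g v v∈G

corollary5p4 : (𝕂 : Field) → (p : ℕ) → HasChar 𝕂 p → AlgClosed 𝕂 →
    (k : Field.Carrier 𝕂 → Set) → IsSubfield 𝕂 k → IsPerfect 𝕂 p k →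
    (m : ℕ) → (a : Fin (suc m) → Field.Carrier 𝕂) →
    (∀ i → k (a i)) → (∀ i → a i ≢ Field.0# 𝕂) → InvLinIndep 𝕂 p (suc m) a →
    IsoOverToGa 𝕂 p k a ×
      ((K : Field.Carrier 𝕂 → Set) → IsSubfield 𝕂 K → (∀ {x} → k x → K x) →
        GroupIsoPoints 𝕂 p K a)
corollary5p4 𝕂 p char _ k k-subfield k-perfect m a a∈k a≢0 independent = iso , points 𝕂 p a iso
  where
  open Reduction 𝕂 p char k k-subfield k-perfect
  iso : IsoOverToGa 𝕂 p k a
  iso = iso-over-k m a (record { in-k = a∈k ; nonzero = a≢0 ; independent = independent })
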